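{- Let $h$ be a multiplicative function with $0\le h(d)\le d$. Let $r$ be a positive integer and $R$ the largest squarefree divisor of $r$. Then for any divisor $s$ of $R$, \[ \sum_{d\mid R}f_r(d)\frac{h(d)}d\prod_{p\mid R/d}\Big(1-\frac{h(p)}p\Big)=H(r)\qquad\text{and}\qquad\sum_{de=s}f_r(d)\mu(e)=J(r,s). \]
   Context: For a positive integer $a$, $r\mapsto f_r(a)$ is the completely multiplicative function of $r$ with $f_p(a)=1-h(p)/p$ if $p\mid a$ and $f_p(a)=-h(p)/p$ if $p\nmid a$. $\mu$ is the Möbius function. $H$ is the multiplicative function $H(n)=\prod_{p^\alpha\|n}\big(\frac{h(p)}p(1-\frac{h(p)}p)^\alpha+(-\frac{h(p)}p)^\alpha(1-\frac{h(p)}p)\big)$, and $J(r,s)=\prod_{p^\alpha\|r,\,p\mid s}\big((1-\frac{h(p)}p)^\alpha-(-\frac{h(p)}p)^\alpha\big)\prod_{p^\alpha\|r,\,p\nmid s}(-\frac{h(p)}p)^\alpha$.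
   Formalization: The multiplicative function h takes rational values. -}

module Defs where

open import Data.Nat as ℕ using (ℕ; zero; suc; _∸_)
open import Data.Nat.Divisibility using (_∣_; _∣?_)
open import Data.Nat.Primality using (Prime; prime?)
open import Data.Nat.Coprimality using (Coprime)
open import Data.Integer using (+_)
open import Data.Rational using (ℚ; 0ℚ; 1ℚ; _+_; _*_; _-_; -_; _≤_) renaming (_/_ to _//_)
open import Data.List using (List; []; _∷_; map; filter; foldr; length; upTo; concatMap)
open import Data.Product using (_×_; _,_)
open import Relation.Nullary using (¬_; Dec; yes; no)
open import Relation.Nullary.Decidable using (¬?)
open import Relation.Binary.PropositionalEquality using (_≡_)

ι : ℕ → ℚ
ι n = + n // 1

-- x / n for n ≥ 1 (the value at n = 0 is irrelevant: only used with n ≥ 1)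
_over_ : ℚ → ℕ → ℚ
x over zero    = 0ℚ
x over (suc n) = x * (+ 1 // suc n)

_^ℚ_ : ℚ → ℕ → ℚ
x ^ℚ zero  = 1ℚ
x ^ℚ suc k = x * (x ^ℚ k)

Σℚ : List ℚ → ℚ
Σℚ = foldr _+_ 0ℚ

Πℚ : List ℚ → ℚ
Πℚ = foldr _*_ 1ℚ

sumOver : {A : Set} → List A → (A → ℚ) → ℚ
sumOver xs F = Σℚ (map F xs)

prodOver : {A : Set} → List A → (A → ℚ) → ℚ
prodOver xs F = Πℚ (map F xs)

-- quotient m / n of naturals (only used when n ∣ m, n ≥ 1)
_div_ : ℕ → ℕ → ℕ
m div zero    = 0
m div (suc n) = m ℕ./ suc n

divisors : ℕ → List ℕ
divisors n = filter (λ d → d ∣? n) (map suc (upTo n))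

primeDivisors : ℕ → List ℕ
primeDivisors n = filter prime? (divisors n)

-- p-adic valuation: the α with p^α ∥ n, for a prime p and n ≥ 1
-- (number of k ∈ {1,…,n} with p^k ∣ n; note α ≤ n)
val : ℕ → ℕ → ℕ
val p n = length (filter (λ k → (p ℕ.^ k) ∣? n) (map suc (upTo n)))

rad : ℕ → ℕ
rad n = foldr ℕ._*_ 1 (primeDivisors n)

μ : ℕ → ℚ
μ n with filter (λ p → (p ℕ.* p) ∣? n) (primeDivisors n)
... | []    = (- 1ℚ) ^ℚ length (primeDivisors n)
... | _ ∷ _ = 0ℚ

factorPairs : ℕ → List (ℕ × ℕ)
factorPairs s = concatMap (λ d → map (λ e → d , e) (filter (λ e → (d ℕ.* e) ℕ.≟ s) (divisors s))) (divisors s)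

Multiplicative : (ℕ → ℚ) → Set
Multiplicative h = (h 1 ≡ 1ℚ) × (∀ m n → Coprime m n → h (m ℕ.* n) ≡ h m * h n)

Bounded : (ℕ → ℚ) → Set
Bounded h = ∀ d → 1 ℕ.≤ d → (0ℚ ≤ h d) × (h d ≤ ι d)

module _ (h : ℕ → ℚ) where

  g : ℕ → ℚ
  g p = h p over p

  fp : ℕ → ℕ → ℚ
  fp p a with p ∣? a
  ... | yes _ = 1ℚ - g p
  ... | no  _ = - g p

  f : ℕ → ℕ → ℚ
  f r a = prodOver (primeDivisors r) (λ p → fp p a ^ℚ val p r)

  H : ℕ → ℚ
  H n = prodOver (primeDivisors n) (λ p →
          g p * ((1ℚ - g p) ^ℚ val p n) + ((- g p) ^ℚ val p n) * (1ℚ - g p))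

  J : ℕ → ℕ → ℚ
  J r s = prodOver (filter (λ p → p ∣? s) (primeDivisors r))
              (λ p → ((1ℚ - g p) ^ℚ val p r) - ((- g p) ^ℚ val p r))
        * prodOver (filter (λ p → ¬? (p ∣? s)) (primeDivisors r))
              (λ p → (- g p) ^ℚ val p r)

{-# OPTIONS --safe #-}
module Submission where

-- Write rad r = p·m with p ∤ m.  The divisors of p·m are the d and the p·d with d ∣ m, and
-- f_r(d) = f_p(d)^α · (the part of f_r over the primes of m), where f_p(d) is -h(p)/p or
-- 1 - h(p)/p according as p ∤ d or p ∣ d.  So each sum over the divisors of p·m is
-- (local factor at p) × (the same sum for m); for the Möbius sum this uses μ(p·n) = -μ(n) on
-- squarefree p·n.  Induction over the primes of r turns both sums into the Euler products
-- H(r) and J(r,s).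

open import Defs
open import Algebra.Bundles using (CommutativeMonoid)
open import Data.Bool using (if_then_else_; true; false)
open import Data.Empty using (⊥)
import Data.Integer as ℤ
open import Data.List using (List; []; _∷_; map; filter; length; upTo; concatMap; _++_; [_])
import Data.List.Properties as List
open import Data.List.Membership.Propositional using (_∈_)
open import Data.List.Membership.Propositional.Properties
  using (∈-filter⁺; ∈-filter⁻; ∈-map⁺; ∈-map⁻; ∈-upTo⁺; ∈-++⁺ˡ; ∈-++⁺ʳ; ∈-++⁻)
open import Data.List.Membership.Propositional.Properties.WithK using (unique∧set⇒bag)
open import Data.List.Relation.Binary.BagAndSetEquality using (∼bag⇒↭)
open import Data.List.Relation.Binary.Permutation.Propositional using (_↭_; ↭⇒↭ₛ)
import Data.List.Relation.Binary.Permutation.Propositional.Properties as ↭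
open import Data.List.Relation.Binary.Permutation.Setoid.Properties using (foldr-commMonoid)
open import Data.List.Relation.Unary.All as All using (All; []; _∷_)
open import Data.List.Relation.Unary.AllPairs using ([]; _∷_)
open import Data.List.Relation.Unary.Any using (here; there)
open import Data.List.Relation.Unary.Unique.Propositional using (Unique)
import Data.List.Relation.Unary.Unique.Propositional.Properties as Unique
open import Data.Nat as ℕ using (ℕ; zero; suc; _≤_; NonZero)
import Data.Nat.Properties as ℕP
open import Data.Nat.Coprimality as Coprime using (Coprime; coprime-divisor)
open import Data.Nat.Divisibility
open import Data.Nat.DivMod using (*-/-assoc; m*n/m*o≡n/o; m*[n/m]≡n; m*n/n≡m)
open import Data.Nat.ListAction using (product)
open import Data.Nat.ListAction.Properties using (∈⇒∣product)
open import Data.Nat.Primality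
  using (Prime; prime?; euclidsLemma; prime⇒irreducible; prime⇒nonZero; productOfPrimes≢0)
open import Data.Product using (_×_; _,_; proj₁; proj₂)
open import Data.Rational using (ℚ; 0ℚ; 1ℚ; _+_; _*_; _-_; -_) renaming (_/_ to _//_)
import Data.Rational.Properties as ℚP
open import Data.Rational.Solver using (module +-*-Solver)
open import Data.Sum using (inj₁; inj₂; reduce)
open import Function using (_∘_; _⇔_; mk⇔; Equivalence)
open import Level using (Level)
open import Relation.Binary.PropositionalEquality
  using (_≡_; _≢_; refl; sym; trans; cong; cong₂; subst; module ≡-Reasoning)
open import Relation.Nullary using (¬_; Dec; yes; no; does; contradiction)
open import Relation.Nullary.Decidable using (¬?; does-⇔)
open import Relation.Unary using (Pred; Decidable)

open +-*-Solver

-- Sums and products over lists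

sumOver-++ : {A : Set} (xs ys : List A) (F : A → ℚ) →
  sumOver (xs ++ ys) F ≡ sumOver xs F + sumOver ys F
sumOver-++ []       ys F = sym (ℚP.+-identityˡ _)
sumOver-++ (x ∷ xs) ys F =
  trans (cong (F x +_) (sumOver-++ xs ys F)) (sym (ℚP.+-assoc (F x) _ _))

sumOver-map : {A B : Set} (f : B → A) (xs : List B) (F : A → ℚ) →
  sumOver (map f xs) F ≡ sumOver xs (F ∘ f)
sumOver-map f xs F = cong Σℚ (sym (List.map-∘ {g = F} {f = f} xs))

sumOver-concatMap : {A B : Set} (G : A → List B) (xs : List A) (F : B → ℚ) →
  sumOver (concatMap G xs) F ≡ sumOver xs (λ x → sumOver (G x) F)
sumOver-concatMap G []       F = refl
sumOver-concatMap G (x ∷ xs) F =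
  trans (sumOver-++ (G x) _ F) (cong (sumOver (G x) F +_) (sumOver-concatMap G xs F))

sumOver-cong : {A : Set} (xs : List A) {F G : A → ℚ} →
  (∀ {x} → x ∈ xs → F x ≡ G x) → sumOver xs F ≡ sumOver xs G
sumOver-cong xs F≡G = cong Σℚ (List.map-cong-local (All.tabulate F≡G))

prodOver-cong : {A : Set} (xs : List A) {F G : A → ℚ} →
  (∀ {x} → x ∈ xs → F x ≡ G x) → prodOver xs F ≡ prodOver xs G
prodOver-cong xs F≡G = cong Πℚ (List.map-cong-local (All.tabulate F≡G))

*-distribˡ-sumOver : {A : Set} (c : ℚ) (xs : List A) (F : A → ℚ) →
  c * sumOver xs F ≡ sumOver xs (λ x → c * F x)
*-distribˡ-sumOver c []       F = ℚP.*-zeroʳ c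
*-distribˡ-sumOver c (x ∷ xs) F =
  trans (ℚP.*-distribˡ-+ c (F x) _) (cong (c * F x +_) (*-distribˡ-sumOver c xs F))

sumOver-↭ : {A : Set} {xs ys : List A} (F : A → ℚ) → xs ↭ ys → sumOver xs F ≡ sumOver ys F
sumOver-↭ F xs↭ys = foldr-commMonoid ℚ+.setoid ℚ+.isCommutativeMonoid (↭⇒↭ₛ (↭.map⁺ F xs↭ys))
  where module ℚ+ = CommutativeMonoid ℚP.+-0-commutativeMonoid

prodOver-↭ : {A : Set} {xs ys : List A} (F : A → ℚ) → xs ↭ ys → prodOver xs F ≡ prodOver ys F
prodOver-↭ F xs↭ys = foldr-commMonoid ℚ*.setoid ℚ*.isCommutativeMonoid (↭⇒↭ₛ (↭.map⁺ F xs↭ys))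
  where module ℚ* = CommutativeMonoid ℚP.*-1-commutativeMonoid

prodOver-partition : {A : Set} {ℓ : Level} {P : Pred A ℓ} (P? : Decidable P) (xs : List A)
  (φ ψ : A → ℚ) →
  prodOver (filter P? xs) φ * prodOver (filter (¬? ∘ P?) xs) ψ
    ≡ prodOver xs (λ x → if does (P? x) then φ x else ψ x)
prodOver-partition P? []       φ ψ = refl
prodOver-partition P? (x ∷ xs) φ ψ with does (P? x)
... | true  = trans (ℚP.*-assoc (φ x) _ _) (cong (φ x *_) (prodOver-partition P? xs φ ψ))
... | false = trans (solve 3 (λ a y b → a :* (y :* b) := y :* (a :* b)) refl
                      (prodOver (filter P? xs) φ) (ψ x) (prodOver (filter (¬? ∘ P?) xs) ψ))
                    (cong (ψ x *_) (prodOver-partition P? xs φ ψ))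

unique-⇔-↭ : {A : Set} {xs ys : List A} → Unique xs → Unique ys →
  (∀ {x} → x ∈ xs ⇔ x ∈ ys) → xs ↭ ys
unique-⇔-↭ u v xs⇔ys = ∼bag⇒↭ (unique∧set⇒bag u v xs⇔ys)

-- Divisors and prime divisors

prime∣prime⇒≡ : ∀ {p q} → Prime p → Prime q → p ∣ q → p ≡ q
prime∣prime⇒≡ pp pq p∣q with prime⇒irreducible pq p∣q
... | inj₁ refl = contradiction pp (λ ())
... | inj₂ p≡q  = p≡q

prime∤⇒coprime : ∀ {p n} → Prime p → ¬ p ∣ n → Coprime p n
prime∤⇒coprime pp p∤n (c∣p , c∣n) with prime⇒irreducible pp c∣p
... | inj₁ c≡1  = c≡1
... | inj₂ refl = contradiction c∣n p∤n

prime∤1 : ∀ {p} → Prime p → ¬ p ∣ 1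
prime∤1 pp p∣1 with ∣1⇒≡1 p∣1
... | refl = contradiction pp (λ ())

∤-divisor : ∀ {p m d} → ¬ p ∣ m → d ∣ m → ¬ p ∣ d
∤-divisor p∤m d∣m p∣d = p∤m (∣-trans p∣d d∣m)

divisor-nonZero : ∀ {m n} .{{_ : NonZero n}} → m ∣ n → NonZero m
divisor-nonZero {zero} {n} 0∣n = contradiction (0∣⇒≡0 0∣n) (ℕ.≢-nonZero⁻¹ n)
divisor-nonZero {suc m}    _   = _

∈-divisors⁺ : ∀ {d n} .{{_ : NonZero n}} → d ∣ n → d ∈ divisors n
∈-divisors⁺ {zero}  {n} 0∣n = contradiction (0∣⇒≡0 0∣n) (ℕ.≢-nonZero⁻¹ n)
∈-divisors⁺ {suc d} {n} d∣n = ∈-filter⁺ (_∣? n) (∈-map⁺ suc (∈-upTo⁺ (∣⇒≤ d∣n))) d∣n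

∈-divisors⁻ : ∀ {d} n → d ∈ divisors n → d ∣ n × NonZero d
∈-divisors⁻ n d∈ with ∈-filter⁻ (_∣? n) {xs = map suc (upTo n)} d∈
... | k∈ , d∣n with ∈-map⁻ suc k∈
... | _ , _ , refl = d∣n , _

divisors-unique : ∀ n → Unique (divisors n)
divisors-unique n = Unique.filter⁺ (_∣? n) (Unique.map⁺ ℕP.suc-injective (Unique.upTo⁺ n))

divisors-*-prime : ∀ {p m} → Prime p → ¬ p ∣ m → .{{_ : NonZero m}} →
  divisors (p ℕ.* m) ↭ divisors m ++ map (p ℕ.*_) (divisors m)
divisors-*-prime {p} {m} pp p∤m = unique-⇔-↭ (divisors-unique (p ℕ.* m))
  (Unique.++⁺ (divisors-unique m) (Unique.map⁺ (ℕP.*-cancelˡ-≡ _ _ p) (divisors-unique m)) disjoint)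
  (mk⇔ to from)
  where
  instance
    p≢0 : NonZero p
    p≢0 = prime⇒nonZero pp
    pm≢0 : NonZero (p ℕ.* m)
    pm≢0 = ℕP.m*n≢0 p m
  disjoint : ∀ {d} → d ∈ divisors m × d ∈ map (p ℕ.*_) (divisors m) → ⊥
  disjoint (d∈ , pk∈) with ∈-map⁻ (p ℕ.*_) pk∈
  ... | k , _ , refl = ∤-divisor p∤m (proj₁ (∈-divisors⁻ m d∈)) (m∣m*n k)
  to : ∀ {d} → d ∈ divisors (p ℕ.* m) → d ∈ divisors m ++ map (p ℕ.*_) (divisors m)
  to {d} d∈ with proj₁ (∈-divisors⁻ (p ℕ.* m) d∈) | p ∣? d
  ... | d∣pm | no p∤d =
    ∈-++⁺ˡ (∈-divisors⁺ (coprime-divisor (Coprime.sym (prime∤⇒coprime pp p∤d)) d∣pm))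
  ... | d∣pm | yes (divides k refl) rewrite ℕP.*-comm k p =
    ∈-++⁺ʳ (divisors m) (∈-map⁺ (p ℕ.*_) (∈-divisors⁺ (*-cancelˡ-∣ p d∣pm)))
  from : ∀ {d} → d ∈ divisors m ++ map (p ℕ.*_) (divisors m) → d ∈ divisors (p ℕ.* m)
  from d∈ with ∈-++⁻ (divisors m) d∈
  ... | inj₁ d∈m = ∈-divisors⁺ (∣n⇒∣m*n p (proj₁ (∈-divisors⁻ m d∈m)))
  ... | inj₂ pk∈ with ∈-map⁻ (p ℕ.*_) pk∈
  ...   | k , k∈ , refl = ∈-divisors⁺ (*-monoʳ-∣ p (proj₁ (∈-divisors⁻ m k∈)))

sumOver-divisors-*-prime : ∀ {p m} → Prime p → ¬ p ∣ m → .{{_ : NonZero m}} →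
  (F G : ℕ → ℚ) (a b : ℚ) →
  (∀ {d} → d ∈ divisors m → F d ≡ a * G d) →
  (∀ {d} → d ∈ divisors m → F (p ℕ.* d) ≡ b * G d) →
  sumOver (divisors (p ℕ.* m)) F ≡ (b + a) * sumOver (divisors m) G
sumOver-divisors-*-prime {p} {m} pp p∤m F G a b F≡aG Fp≡bG = begin
  sumOver (divisors (p ℕ.* m)) F
    ≡⟨ sumOver-↭ F (divisors-*-prime pp p∤m) ⟩
  sumOver (divisors m ++ map (p ℕ.*_) (divisors m)) F
    ≡⟨ sumOver-++ (divisors m) _ F ⟩
  sumOver (divisors m) F + sumOver (map (p ℕ.*_) (divisors m)) F
    ≡⟨ cong (sumOver (divisors m) F +_) (sumOver-map (p ℕ.*_) (divisors m) F) ⟩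
  sumOver (divisors m) F + sumOver (divisors m) (F ∘ (p ℕ.*_))
    ≡⟨ cong₂ _+_ (sumOver-cong (divisors m) F≡aG) (sumOver-cong (divisors m) Fp≡bG) ⟩
  sumOver (divisors m) (λ d → a * G d) + sumOver (divisors m) (λ d → b * G d)
    ≡⟨ cong₂ _+_ (*-distribˡ-sumOver a (divisors m) G) (*-distribˡ-sumOver b (divisors m) G) ⟨
  a * ΣG + b * ΣG
    ≡⟨ trans (ℚP.*-distribʳ-+ ΣG b a) (ℚP.+-comm (b * ΣG) (a * ΣG)) ⟨
  (b + a) * ΣG ∎
  where
  open ≡-Reasoning
  ΣG = sumOver (divisors m) G

∈-primeDivisors⁺ : ∀ {q n} .{{_ : NonZero n}} → Prime q → q ∣ n → q ∈ primeDivisors n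
∈-primeDivisors⁺ pq q∣n = ∈-filter⁺ prime? (∈-divisors⁺ q∣n) pq

∈-primeDivisors⁻ : ∀ {q} n → q ∈ primeDivisors n → Prime q × q ∣ n
∈-primeDivisors⁻ n q∈ with ∈-filter⁻ prime? {xs = divisors n} q∈
... | q∈divisors , pq = pq , proj₁ (∈-divisors⁻ n q∈divisors)

primeDivisors-unique : ∀ n → Unique (primeDivisors n)
primeDivisors-unique n = Unique.filter⁺ prime? (divisors-unique n)

primeDivisors-*-prime : ∀ {p m} → Prime p → ¬ p ∣ m → .{{_ : NonZero m}} →
  primeDivisors (p ℕ.* m) ↭ p ∷ primeDivisors m
primeDivisors-*-prime {p} {m} pp p∤m = unique-⇔-↭ (primeDivisors-unique (p ℕ.* m))
  (All.tabulate p≢ ∷ primeDivisors-unique m) (mk⇔ to from)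
  where
  instance
    pm≢0 : NonZero (p ℕ.* m)
    pm≢0 = ℕP.m*n≢0 p m {{prime⇒nonZero pp}}
  p≢ : ∀ {q} → q ∈ primeDivisors m → p ≢ q
  p≢ q∈ refl = p∤m (proj₂ (∈-primeDivisors⁻ m q∈))
  to : ∀ {q} → q ∈ primeDivisors (p ℕ.* m) → q ∈ p ∷ primeDivisors m
  to q∈ with ∈-primeDivisors⁻ (p ℕ.* m) q∈
  ... | pq , q∣pm with euclidsLemma p m pq q∣pm
  ...   | inj₁ q∣p = here (prime∣prime⇒≡ pq pp q∣p)
  ...   | inj₂ q∣m = there (∈-primeDivisors⁺ pq q∣m)
  from : ∀ {q} → q ∈ p ∷ primeDivisors m → q ∈ primeDivisors (p ℕ.* m)
  from (here refl) = ∈-primeDivisors⁺ pp (m∣m*n m)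
  from (there q∈) with ∈-primeDivisors⁻ m q∈
  ... | pq , q∣m = ∈-primeDivisors⁺ pq (∣n⇒∣m*n p q∣m)

data DistinctPrimes : List ℕ → Set where
  []   : DistinctPrimes []
  cons : ∀ {p ps} → Prime p → ¬ p ∣ product ps → DistinctPrimes ps → DistinctPrimes (p ∷ ps)

DistinctPrimes⇒AllPrime : ∀ {ps} → DistinctPrimes ps → All Prime ps
DistinctPrimes⇒AllPrime []              = []
DistinctPrimes⇒AllPrime (cons pp _ dps) = pp ∷ DistinctPrimes⇒AllPrime dps

product-nonZero : ∀ {ps} → DistinctPrimes ps → NonZero (product ps)
product-nonZero = productOfPrimes≢0 ∘ DistinctPrimes⇒AllPrime

prime∤product : ∀ {p qs} → Prime p → All Prime qs → All (p ≢_) qs → ¬ p ∣ product qs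
prime∤product {qs = []}     pp []         []           = prime∤1 pp
prime∤product {qs = q ∷ qs} pp (pq ∷ pqs) (p≢q ∷ p≢qs) p∣qm
  with euclidsLemma q (product qs) pp p∣qm
... | inj₁ p∣q  = p≢q (prime∣prime⇒≡ pp pq p∣q)
... | inj₂ p∣qs = prime∤product pp pqs p≢qs p∣qs

unique-primes⇒DistinctPrimes : ∀ {ps} → All Prime ps → Unique ps → DistinctPrimes ps
unique-primes⇒DistinctPrimes []         []           = []
unique-primes⇒DistinctPrimes (pp ∷ pps) (p≢ps ∷ ups) =
  cons pp (prime∤product pp pps p≢ps) (unique-primes⇒DistinctPrimes pps ups)

primeDivisors-distinct : ∀ n → DistinctPrimes (primeDivisors n)
primeDivisors-distinct n = unique-primes⇒DistinctPrimes
  (All.tabulate (proj₁ ∘ ∈-primeDivisors⁻ n)) (primeDivisors-unique n)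

∣*-head⇔∣ : ∀ {p ps q d} → DistinctPrimes (p ∷ ps) → q ∈ ps → q ∣ p ℕ.* d ⇔ q ∣ d
∣*-head⇔∣ {p} {ps} {q} {d} (cons pp p∤ps dps) q∈ = mk⇔ to (∣n⇒∣m*n p)
  where
  pq = All.lookup (DistinctPrimes⇒AllPrime dps) q∈
  to : q ∣ p ℕ.* d → q ∣ d
  to q∣pd with euclidsLemma p d pq q∣pd
  ... | inj₁ q∣p =
    contradiction (subst (_∣ product ps) (prime∣prime⇒≡ pq pp q∣p) (∈⇒∣product q∈)) p∤ps
  ... | inj₂ q∣d = q∣d

-- Squarefree numbers and the Möbius function

SquareFree : ℕ → Set
SquareFree n = ∀ {q} → Prime q → ¬ q ℕ.* q ∣ n

squareFree-∣ : ∀ {m n} → m ∣ n → SquareFree n → SquareFree m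
squareFree-∣ m∣n sqf pq qq∣m = sqf pq (∣-trans qq∣m m∣n)

product-squareFree : ∀ {ps} → DistinctPrimes ps → SquareFree (product ps)
product-squareFree []                    {q} pq qq∣1  = prime∤1 pq (∣-trans (m∣m*n q) qq∣1)
product-squareFree (cons {p} pp p∤m dps) {q} pq qq∣pm with p ∣? q ℕ.* q
... | no p∤qq =
  product-squareFree dps pq (coprime-divisor (Coprime.sym (prime∤⇒coprime pp p∤qq)) qq∣pm)
... | yes p∣qq with prime∣prime⇒≡ pp pq (reduce (euclidsLemma q q pp p∣qq))
...   | refl = p∤m (*-cancelˡ-∣ p {{prime⇒nonZero pp}} qq∣pm)

μ-squareFree : ∀ {n} → SquareFree n → μ n ≡ (- 1ℚ) ^ℚ length (primeDivisors n)
μ-squareFree {n} sqf rewrite List.filter-none (λ p → (p ℕ.* p) ∣? n) {xs = primeDivisors n}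
  (All.tabulate (λ q∈ → sqf (proj₁ (∈-primeDivisors⁻ n q∈)))) = refl

μ-*-prime : ∀ {p m} → Prime p → ¬ p ∣ m → .{{_ : NonZero m}} → SquareFree (p ℕ.* m) →
  μ (p ℕ.* m) ≡ - μ m
μ-*-prime {p} {m} pp p∤m sqf
  rewrite μ-squareFree sqf | μ-squareFree (squareFree-∣ (n∣m*n p) sqf)
        | ↭.↭-length (primeDivisors-*-prime pp p∤m)
  = trans (sym (ℚP.neg-distribˡ-* 1ℚ x)) (cong -_ (ℚP.*-identityˡ x))
  where x = (- 1ℚ) ^ℚ length (primeDivisors m)

*-div-assoc : ∀ p {m} d .{{_ : NonZero d}} → d ∣ m → (p ℕ.* m) div d ≡ p ℕ.* (m div d)
*-div-assoc p (suc d) = *-/-assoc p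

*-div-*-cancelˡ : ∀ p {m} d .{{_ : NonZero p}} .{{_ : NonZero d}} →
  (p ℕ.* m) div (p ℕ.* d) ≡ m div d
*-div-*-cancelˡ (suc p) {m} (suc d) = m*n/m*o≡n/o (suc p) m (suc d)

div-∣ : ∀ {m} d .{{_ : NonZero d}} → d ∣ m → m div d ∣ m
div-∣ (suc d) = m/n∣m

m*[n-div-m]≡n : ∀ {n} m .{{_ : NonZero m}} → m ∣ n → m ℕ.* (n div m) ≡ n
m*[n-div-m]≡n (suc m) = m*[n/m]≡n

m*n-div-m≡n : ∀ m n .{{_ : NonZero m}} → (m ℕ.* n) div m ≡ n
m*n-div-m≡n (suc m) n = trans (cong (ℕ._/ suc m) (ℕP.*-comm (suc m) n)) (m*n/n≡m n (suc m))

1/-*-1/ : ∀ m n .{{_ : NonZero m}} .{{_ : NonZero n}} →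
  (ℤ.+ 1 // m) * (ℤ.+ 1 // n) ≡ (ℤ.+ 1 // (m ℕ.* n)) {{ℕP.m*n≢0 m n}}
1/-*-1/ (suc m) (suc n)
  rewrite ℚP.normalize-coprime {1} {m} (Coprime.1-coprimeTo (suc m))
        | ℚP.normalize-coprime {1} {n} (Coprime.1-coprimeTo (suc n)) = refl

over-* : ∀ x y m n .{{_ : NonZero m}} .{{_ : NonZero n}} →
  (x * y) over (m ℕ.* n) ≡ (x over m) * (y over n)
over-* x y (suc m) (suc n) = trans (cong ((x * y) *_) (sym (1/-*-1/ (suc m) (suc n))))
  (solve 4 (λ x y u v → (x :* y) :* (u :* v) := (x :* u) :* (y :* v)) refl
    x y (ℤ.+ 1 // suc m) (ℤ.+ 1 // suc n))

-- The identities over an arbitrary list of distinct primes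

module _ (h : ℕ → ℚ) where

  fp-∣ : ∀ {p d} → p ∣ d → fp h p d ≡ 1ℚ - g h p
  fp-∣ {p} {d} p∣d with p ∣? d
  ... | yes _   = refl
  ... | no p∤d = contradiction p∣d p∤d

  fp-∤ : ∀ {p d} → ¬ p ∣ d → fp h p d ≡ - g h p
  fp-∤ {p} {d} p∤d with p ∣? d
  ... | yes p∣d = contradiction p∣d p∤d
  ... | no _    = refl

  fp-cong : ∀ {p x y} → p ∣ x ⇔ p ∣ y → fp h p x ≡ fp h p y
  fp-cong {p} {x} {y} x⇔y = by-cases (p ∣? y)
    where
    by-cases : Dec (p ∣ y) → fp h p x ≡ fp h p y
    by-cases (yes p∣y) = trans (fp-∣ (Equivalence.from x⇔y p∣y)) (sym (fp-∣ p∣y))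
    by-cases (no p∤y)  = trans (fp-∤ (p∤y ∘ Equivalence.to x⇔y)) (sym (fp-∤ p∤y))

  -- f_r(d) for r = ∏_{q ∈ ps} q ^ α q, so that f h r = fFactored (λ p → val p r) (primeDivisors r).
  fFactored : (ℕ → ℕ) → List ℕ → ℕ → ℚ
  fFactored α ps d = prodOver ps (λ q → fp h q d ^ℚ α q)

  fFactored-∤ : ∀ α {p} ps {d} → ¬ p ∣ d →
    fFactored α (p ∷ ps) d ≡ (- g h p) ^ℚ α p * fFactored α ps d
  fFactored-∤ α ps p∤d = cong (λ x → x ^ℚ α _ * fFactored α ps _) (fp-∤ p∤d)

  fFactored-* : ∀ α {p ps} d → DistinctPrimes (p ∷ ps) →
    fFactored α (p ∷ ps) (p ℕ.* d) ≡ (1ℚ - g h p) ^ℚ α p * fFactored α ps d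
  fFactored-* α {p} {ps} d dps = cong₂ (λ x y → x ^ℚ α p * y) (fp-∣ {p} (m∣m*n d))
    (prodOver-cong ps (λ q∈ → cong (_^ℚ α _) (fp-cong (∣*-head⇔∣ dps q∈))))

  ∏[1-g] : ℕ → ℚ
  ∏[1-g] n = prodOver (primeDivisors n) (λ q → 1ℚ - g h q)

  ∏[1-g]-*-prime : ∀ {p m} → Prime p → ¬ p ∣ m → .{{_ : NonZero m}} →
    ∏[1-g] (p ℕ.* m) ≡ (1ℚ - g h p) * ∏[1-g] m
  ∏[1-g]-*-prime pp p∤m = prodOver-↭ (λ q → 1ℚ - g h q) (primeDivisors-*-prime pp p∤m)

  Hsummand : (ℕ → ℕ) → List ℕ → ℕ → ℚ
  Hsummand α ps d = fFactored α ps d * (h d over d) * ∏[1-g] (product ps div d)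

  Hfactor : (ℕ → ℕ) → ℕ → ℚ
  Hfactor α p = g h p * ((1ℚ - g h p) ^ℚ α p) + ((- g h p) ^ℚ α p) * (1ℚ - g h p)

  Hsummand-∤ : ∀ α {p ps d} → DistinctPrimes (p ∷ ps) → d ∈ divisors (product ps) →
    Hsummand α (p ∷ ps) d ≡ ((- g h p) ^ℚ α p * (1ℚ - g h p)) * Hsummand α ps d
  Hsummand-∤ α {p} {ps} {d} (cons pp p∤m dps) d∈ = begin
    fFactored α (p ∷ ps) d * hd * ∏[1-g] ((p ℕ.* m) div d)
      ≡⟨ cong₂ (λ x n → x * hd * ∏[1-g] n) (fFactored-∤ α ps (∤-divisor p∤m d∣m))
                                          (*-div-assoc p d d∣m) ⟩
    ψ * fFactored α ps d * hd * ∏[1-g] (p ℕ.* (m div d))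
      ≡⟨ cong (ψ * fFactored α ps d * hd *_) (∏[1-g]-*-prime pp (∤-divisor p∤m (div-∣ d d∣m))) ⟩
    ψ * fFactored α ps d * hd * ((1ℚ - g h p) * ∏[1-g] (m div d))
      ≡⟨ solve 5 (λ a f x b c → a :* f :* x :* (b :* c) := a :* b :* (f :* x :* c)) refl
           ψ (fFactored α ps d) hd (1ℚ - g h p) (∏[1-g] (m div d)) ⟩
    ψ * (1ℚ - g h p) * Hsummand α ps d ∎
    where
    open ≡-Reasoning
    m = product ps
    hd = h d over d
    ψ = (- g h p) ^ℚ α p
    d∣m = proj₁ (∈-divisors⁻ m d∈)
    instance
      m≢0 : NonZero m
      m≢0 = product-nonZero dps
      d≢0 : NonZero d
      d≢0 = proj₂ (∈-divisors⁻ m d∈)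
      m/d≢0 : NonZero (m div d)
      m/d≢0 = divisor-nonZero (div-∣ d d∣m)

  Hsummand-* : Multiplicative h → ∀ α {p ps d} → DistinctPrimes (p ∷ ps) →
    d ∈ divisors (product ps) →
    Hsummand α (p ∷ ps) (p ℕ.* d) ≡ (g h p * (1ℚ - g h p) ^ℚ α p) * Hsummand α ps d
  Hsummand-* (_ , h-*) α {p} {ps} {d} dps@(cons pp p∤m _) d∈ = begin
    fFactored α (p ∷ ps) (p ℕ.* d) * (h (p ℕ.* d) over (p ℕ.* d)) * ∏[1-g] ((p ℕ.* m) div (p ℕ.* d))
      ≡⟨ cong₂ (λ x y → x * y * ∏[1-g] ((p ℕ.* m) div (p ℕ.* d))) (fFactored-* α d dps) h[pd]/pd ⟩
    a * fFactored α ps d * (g h p * hd) * ∏[1-g] ((p ℕ.* m) div (p ℕ.* d))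
      ≡⟨ cong (λ n → a * fFactored α ps d * (g h p * hd) * ∏[1-g] n) (*-div-*-cancelˡ p d) ⟩
    a * fFactored α ps d * (g h p * hd) * ∏[1-g] (m div d)
      ≡⟨ solve 5 (λ a f b x c → a :* f :* (b :* x) :* c := b :* a :* (f :* x :* c)) refl
           a (fFactored α ps d) (g h p) hd (∏[1-g] (m div d)) ⟩
    g h p * a * Hsummand α ps d ∎
    where
    open ≡-Reasoning
    m = product ps
    hd = h d over d
    a = (1ℚ - g h p) ^ℚ α p
    d∣m = proj₁ (∈-divisors⁻ m d∈)
    instance
      p≢0 : NonZero p
      p≢0 = prime⇒nonZero pp
      d≢0 : NonZero d
      d≢0 = proj₂ (∈-divisors⁻ m d∈)
    h[pd]/pd : h (p ℕ.* d) over (p ℕ.* d) ≡ g h p * hd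
    h[pd]/pd = trans (cong (_over (p ℕ.* d)) (h-* p d (prime∤⇒coprime pp (∤-divisor p∤m d∣m))))
                     (over-* (h p) (h d) p d)

  sumOver-Hsummand : Multiplicative h → ∀ α {ps} → DistinctPrimes ps →
    sumOver (divisors (product ps)) (Hsummand α ps) ≡ prodOver ps (Hfactor α)
  sumOver-Hsummand (h1≡1 , _) α [] rewrite h1≡1 = refl
  sumOver-Hsummand mult α {p ∷ ps} dps@(cons pp p∤m dps′) = begin
    sumOver (divisors (p ℕ.* product ps)) (Hsummand α (p ∷ ps))
      ≡⟨ sumOver-divisors-*-prime pp p∤m (Hsummand α (p ∷ ps)) (Hsummand α ps)
           ((- g h p) ^ℚ α p * (1ℚ - g h p)) (g h p * (1ℚ - g h p) ^ℚ α p)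
           (Hsummand-∤ α dps) (Hsummand-* mult α dps) ⟩
    Hfactor α p * sumOver (divisors (product ps)) (Hsummand α ps)
      ≡⟨ cong (Hfactor α p *_) (sumOver-Hsummand mult α dps′) ⟩
    prodOver (p ∷ ps) (Hfactor α) ∎
    where
    open ≡-Reasoning
    instance
      m≢0 : NonZero (product ps)
      m≢0 = product-nonZero dps′

  Jfactor : (ℕ → ℕ) → ℕ → ℕ → ℚ
  Jfactor α s q =
    if does (q ∣? s) then (1ℚ - g h q) ^ℚ α q - (- g h q) ^ℚ α q else (- g h q) ^ℚ α q

  Jfactor-cong : ∀ α {s t q} → q ∣ s ⇔ q ∣ t → Jfactor α s q ≡ Jfactor α t q
  Jfactor-cong α {s} {t} {q} s⇔t rewrite does-⇔ s⇔t (q ∣? s) (q ∣? t) = refl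

  Jsummand : (ℕ → ℕ) → List ℕ → ℕ → ℕ → ℚ
  Jsummand α ps s d = fFactored α ps d * μ (s div d)

  Jsummand-∤ : ∀ α {p} ps s {d} → ¬ p ∣ d →
    Jsummand α (p ∷ ps) s d ≡ (- g h p) ^ℚ α p * Jsummand α ps s d
  Jsummand-∤ α {p} ps s {d} p∤d = trans (cong (_* μ (s div d)) (fFactored-∤ α ps p∤d))
    (ℚP.*-assoc ((- g h p) ^ℚ α p) (fFactored α ps d) (μ (s div d)))

  Jsummand-*-∤ : ∀ α {p ps t d} → DistinctPrimes (p ∷ ps) → t ∣ product ps → d ∈ divisors t →
    Jsummand α (p ∷ ps) (p ℕ.* t) d ≡ (- (- g h p) ^ℚ α p) * Jsummand α ps t d
  Jsummand-*-∤ α {p} {ps} {t} {d} dps@(cons pp p∤m dps′) t∣m d∈ = begin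
    fFactored α (p ∷ ps) d * μ ((p ℕ.* t) div d)
      ≡⟨ cong₂ (λ x n → x * μ n) (fFactored-∤ α ps (∤-divisor p∤m d∣m)) (*-div-assoc p d d∣t) ⟩
    ψ * fFactored α ps d * μ (p ℕ.* (t div d))
      ≡⟨ cong (ψ * fFactored α ps d *_) (μ-*-prime pp (∤-divisor p∤m t/d∣m) squareFree) ⟩
    ψ * fFactored α ps d * (- μ (t div d))
      ≡⟨ solve 3 (λ a f x → a :* f :* (:- x) := (:- a) :* (f :* x)) refl
           ψ (fFactored α ps d) (μ (t div d)) ⟩
    (- ψ) * Jsummand α ps t d ∎
    where
    open ≡-Reasoning
    ψ = (- g h p) ^ℚ α p
    d∣t = proj₁ (∈-divisors⁻ t d∈)
    d∣m = ∣-trans d∣t t∣m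
    instance
      d≢0 : NonZero d
      d≢0 = proj₂ (∈-divisors⁻ t d∈)
    t/d∣m = ∣-trans (div-∣ d d∣t) t∣m
    instance
      t/d≢0 : NonZero (t div d)
      t/d≢0 = divisor-nonZero {{product-nonZero dps′}} t/d∣m
    squareFree : SquareFree (p ℕ.* (t div d))
    squareFree = squareFree-∣ (*-monoʳ-∣ p t/d∣m) (product-squareFree dps)

  Jsummand-*-* : ∀ α {p ps t d} → DistinctPrimes (p ∷ ps) → d ∈ divisors t →
    Jsummand α (p ∷ ps) (p ℕ.* t) (p ℕ.* d) ≡ (1ℚ - g h p) ^ℚ α p * Jsummand α ps t d
  Jsummand-*-* α {p} {ps} {t} {d} dps@(cons pp _ _) d∈ =
    trans (cong₂ _*_ (fFactored-* α d dps) (cong μ (*-div-*-cancelˡ p d)))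
          (ℚP.*-assoc ((1ℚ - g h p) ^ℚ α p) (fFactored α ps d) (μ (t div d)))
    where
    instance
      p≢0 : NonZero p
      p≢0 = prime⇒nonZero pp
      d≢0 : NonZero d
      d≢0 = proj₂ (∈-divisors⁻ t d∈)

  sumOver-Jsummand-∤ : ∀ α {p} ps {s} → ¬ p ∣ s →
    sumOver (divisors s) (Jsummand α (p ∷ ps) s)
      ≡ (- g h p) ^ℚ α p * sumOver (divisors s) (Jsummand α ps s)
  sumOver-Jsummand-∤ α {p} ps {s} p∤s = begin
    sumOver (divisors s) (Jsummand α (p ∷ ps) s)
      ≡⟨ sumOver-cong (divisors s) (λ d∈ →
           Jsummand-∤ α ps s (∤-divisor p∤s (proj₁ (∈-divisors⁻ s d∈)))) ⟩
    sumOver (divisors s) (λ d → (- g h p) ^ℚ α p * Jsummand α ps s d)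
      ≡⟨ *-distribˡ-sumOver ((- g h p) ^ℚ α p) (divisors s) (Jsummand α ps s) ⟨
    (- g h p) ^ℚ α p * sumOver (divisors s) (Jsummand α ps s) ∎
    where open ≡-Reasoning

  sumOver-Jsummand-*-prime : ∀ α {p ps t} → DistinctPrimes (p ∷ ps) → t ∣ product ps →
    sumOver (divisors (p ℕ.* t)) (Jsummand α (p ∷ ps) (p ℕ.* t))
      ≡ ((1ℚ - g h p) ^ℚ α p - (- g h p) ^ℚ α p) * sumOver (divisors t) (Jsummand α ps t)
  sumOver-Jsummand-*-prime α {p} {ps} {t} dps@(cons pp p∤m dps′) t∣m =
    sumOver-divisors-*-prime pp (∤-divisor p∤m t∣m)
      (Jsummand α (p ∷ ps) (p ℕ.* t)) (Jsummand α ps t) (- (- g h p) ^ℚ α p) ((1ℚ - g h p) ^ℚ α p)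
      (Jsummand-*-∤ α dps t∣m) (Jsummand-*-* α dps)
    where
    instance
      t≢0 : NonZero t
      t≢0 = divisor-nonZero {{product-nonZero dps′}} t∣m

  sumOver-Jsummand : ∀ α {ps s} → DistinctPrimes ps → s ∣ product ps →
    sumOver (divisors s) (Jsummand α ps s) ≡ prodOver ps (Jfactor α s)
  sumOver-Jsummand α []  s∣1 rewrite ∣1⇒≡1 s∣1 = refl
  sumOver-Jsummand α {p ∷ ps} {s} dps@(cons pp _ dps′) s∣pm with p ∣? s
  ... | no p∤s = trans (sumOver-Jsummand-∤ α ps p∤s) (cong ((- g h p) ^ℚ α p *_)
    (sumOver-Jsummand α dps′ (coprime-divisor (Coprime.sym (prime∤⇒coprime pp p∤s)) s∣pm)))
  ... | yes (divides t refl) rewrite ℕP.*-comm t p =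
    trans (sumOver-Jsummand-*-prime α dps t∣m) (cong (((1ℚ - g h p) ^ℚ α p - (- g h p) ^ℚ α p) *_)
      (trans (sumOver-Jsummand α dps′ t∣m)
             (sym (prodOver-cong ps (λ q∈ → Jfactor-cong α (∣*-head⇔∣ dps q∈))))))
    where
    t∣m : t ∣ product ps
    t∣m = *-cancelˡ-∣ p {{prime⇒nonZero pp}} s∣pm

sumOver-factorPairs : ∀ s .{{_ : NonZero s}} (F : ℕ × ℕ → ℚ) →
  sumOver (factorPairs s) F ≡ sumOver (divisors s) (λ d → F (d , s div d))
sumOver-factorPairs s F =
  trans (sumOver-concatMap _ (divisors s) F) (sumOver-cong (divisors s) sumOver-cofactors)
  where
  cofactor? : (d e : ℕ) → Dec (d ℕ.* e ≡ s)
  cofactor? d e = d ℕ.* e ℕ.≟ s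

  cofactors : ℕ → List ℕ
  cofactors d = filter (cofactor? d) (divisors s)

  cofactors↭ : ∀ {d} → d ∈ divisors s → cofactors d ↭ [ s div d ]
  cofactors↭ {d} d∈ =
    unique-⇔-↭ (Unique.filter⁺ (cofactor? d) (divisors-unique s)) ([] ∷ []) (mk⇔ to from)
    where
    instance
      d≢0 : NonZero d
      d≢0 = proj₂ (∈-divisors⁻ s d∈)
    to : ∀ {e} → e ∈ cofactors d → e ∈ [ s div d ]
    to {e} e∈ = here (trans (sym (m*n-div-m≡n d e))
      (cong (_div d) (proj₂ (∈-filter⁻ (cofactor? d) {xs = divisors s} e∈))))
    from : ∀ {e} → e ∈ [ s div d ] → e ∈ cofactors d
    from (here refl) = ∈-filter⁺ (cofactor? d) (∈-divisors⁺ (div-∣ d d∣s)) (m*[n-div-m]≡n d d∣s)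
      where d∣s = proj₁ (∈-divisors⁻ s d∈)

  sumOver-cofactors : ∀ {d} → d ∈ divisors s →
    sumOver (map (d ,_) (cofactors d)) F ≡ F (d , s div d)
  sumOver-cofactors {d} d∈ = begin
    sumOver (map (d ,_) (cofactors d)) F ≡⟨ sumOver-map (d ,_) (cofactors d) F ⟩
    sumOver (cofactors d) (F ∘ (d ,_))   ≡⟨ sumOver-↭ (F ∘ (d ,_)) (cofactors↭ d∈) ⟩
    F (d , s div d) + 0ℚ                 ≡⟨ ℚP.+-identityʳ _ ⟩
    F (d , s div d)                      ∎
    where open ≡-Reasoning

lemma4p3 : (h : ℕ → ℚ) → Multiplicative h → Bounded h →
    (r : ℕ) → 1 ≤ r → (s : ℕ) → s ∣ rad r →
      (sumOver (divisors (rad r)) (λ d →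
          f h r d * (h d over d) * prodOver (primeDivisors (rad r div d)) (λ p → 1ℚ - g h p))
        ≡ H h r)
      × (sumOver (factorPairs s) (λ de → f h r (proj₁ de) * μ (proj₂ de)) ≡ J h r s)
lemma4p3 h mult _ r _ s s∣rad = sumOver-Hsummand h mult α (primeDivisors-distinct r) , (begin
  sumOver (factorPairs s) (λ de → f h r (proj₁ de) * μ (proj₂ de))
    ≡⟨ sumOver-factorPairs s _ ⟩
  sumOver (divisors s) (Jsummand h α (primeDivisors r) s)
    ≡⟨ sumOver-Jsummand h α (primeDivisors-distinct r) s∣rad ⟩
  prodOver (primeDivisors r) (Jfactor h α s)
    ≡⟨ prodOver-partition (_∣? s) (primeDivisors r) _ _ ⟨
  J h r s ∎)
  where
  open ≡-Reasoning
  α : ℕ → ℕ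
  α p = val p r
  instance
    s≢0 : NonZero s
    s≢0 = divisor-nonZero {{product-nonZero (primeDivisors-distinct r)}} s∣rad
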